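{- Let $C$ and $D$ be reflexive symmetric cycles of lengths $m$ and $n$ respectively, with $4\le n\le m$. For each integer $w$, the graph $\mathrm{Hom}_w(C,D)$ consists of (1) a single component if $0\le |w|<m/n$, and (2) $n$ isolated vertices if $0<|w|=m/n$; and it is empty if $m/n<|w|$.
   Context: A reflexive symmetric cycle $C=c_0c_1\dots c_{m-1}c_0$ is a graph cycle of length $m$ in which every vertex has a loop and every edge $c_{i}c_{i+1}$ (indices mod $m$) is an arc in both directions. Write $D=(0)(1)\dots(n-1)(0)$ with vertex set $\mathbb{Z}_n$. A homomorphism $\phi:C\to D$ is a map preserving arcs. $\mathrm{Hom}(C,D)$ is the digraph on homomorphisms with $\phi\to\phi'$ iff for all $u,v$, $u\to v$ implies $\phi(u)\to\phi'(v)$; components are connected components of its underlying graph. For $\phi:C\to D$, the edge $c_ic_{i+1}$ is increasing, stationary or decreasing according as $\phi(c_{i+1})-\phi(c_i)$ is $1,0,-1$ in $\mathbb{Z}_n$; the increase of $\phi$ is (#increasing edges) $-$ (#decreasing edges), and the wind of $\phi$ is the increase divided by $n$. $\mathrm{Hom}_w(C,D)$ is the subgraph of $\mathrm{Hom}(C,D)$ induced by maps of wind $w$. -}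

module Defs where

open import Data.Nat using (ℕ; zero; suc; _+_)
open import Data.Nat.DivMod using (_mod_)
open import Data.Integer as ℤ using (ℤ; +_; -_)
open import Data.Fin using (Fin; toℕ)
open import Data.List using (foldr; allFin)
open import Data.Product using (Σ; _×_; proj₁)
open import Data.Sum using (_⊎_)
open import Relation.Binary.PropositionalEquality using (_≡_)
open import Relation.Nullary using (yes; no)
open import Data.Nat.Properties using (_≟_)
open import Relation.Binary.Construct.Closure.ReflexiveTransitive using (Star)

-- Vertices of a cycle of length k are Fin k (i.e. ℤ_k).
-- Step k a b : b = a + 1 in ℤ_k.
Step : (k : ℕ) → Fin k → Fin k → Set
Step k a b = (suc (toℕ a) ≡ toℕ b) ⊎ ((suc (toℕ a) ≡ k) × (toℕ b ≡ 0))

Arc : (k : ℕ) → Fin k → Fin k → Set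
Arc k a b = (a ≡ b) ⊎ (Step k a b ⊎ Step k b a)

next : ∀ {k} → Fin k → Fin k
next {suc k} i = suc (toℕ i) mod (suc k)

Hom : ℕ → ℕ → Set
Hom m n = Σ (Fin m → Fin n) λ φ → ∀ u v → Arc m u v → Arc n (φ u) (φ v)

-- contribution of an edge whose endpoints map to a, b:
-- +1 if b = a+1, -1 if a = b+1 (in ℤ_k), 0 otherwise
delta : (k : ℕ) → Fin k → Fin k → ℤ
delta k a b with suc (toℕ a) ≟ toℕ b
... | yes _ = + 1
... | no _ with suc (toℕ b) ≟ toℕ a
...   | yes _ = - (+ 1)
...   | no _ with suc (toℕ a) ≟ k | toℕ b ≟ 0
...     | yes _ | yes _ = + 1
...     | _ | _ with suc (toℕ b) ≟ k | toℕ a ≟ 0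
...       | yes _ | yes _ = - (+ 1)
...       | _ | _ = + 0

increase : ∀ {m n} → Hom m n → ℤ
increase {m} {n} h =
  foldr (λ i acc → delta n (proj₁ h i) (proj₁ h (next i)) ℤ.+ acc) (+ 0) (allFin m)

HomW : ℕ → ℕ → ℤ → Set
HomW m n w = Σ (Hom m n) λ h → increase h ≡ w ℤ.* (+ n)

HArc : ∀ {m n} → Hom m n → Hom m n → Set
HArc {m} {n} φ ψ = ∀ u v → Arc m u v → Arc n (proj₁ φ u) (proj₁ ψ v)

Adj : ∀ {m n w} → HomW m n w → HomW m n w → Set
Adj φ ψ = HArc (proj₁ φ) (proj₁ ψ) ⊎ HArc (proj₁ ψ) (proj₁ φ)

SameMap : ∀ {m n w} → HomW m n w → HomW m n w → Set
SameMap {m} φ ψ = ∀ (u : Fin m) → proj₁ (proj₁ φ) u ≡ proj₁ (proj₁ ψ) u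

SingleComponent : ℕ → ℕ → ℤ → Set
SingleComponent m n w =
  HomW m n w × (∀ (φ ψ : HomW m n w) → Star (Adj {m} {n} {w}) φ ψ)

IsolatedVertices : ℕ → ℕ → ℤ → ℕ → Set
IsolatedVertices m n w k =
  Σ (Fin k → HomW m n w) λ e →
    (∀ i j → SameMap {m} {n} {w} (e i) (e j) → i ≡ j)
    × (∀ (φ : HomW m n w) → Σ (Fin k) λ i → SameMap {m} {n} {w} φ (e i))
    × (∀ (φ ψ : HomW m n w) → Adj {m} {n} {w} φ ψ → SameMap {m} {n} {w} φ ψ)

Empty : ℕ → ℕ → ℤ → Set
Empty m n w = HomW m n w → Data.Empty.⊥
  where import Data.Empty

module Submission where

-- A homomorphism C → D of wind w lifts to a height function L : C → ℤ that changes by at most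
-- one along each edge of the path c₀ … c_{m-1} and increases by T = w n in total around the
-- cycle; conversely every such height function projects to a homomorphism of wind w, and maps
-- whose lifts are close are adjacent in Hom(C, D).  The m slopes of a lift are unit steps summing
-- to T, so |T| ≤ m.  If |T| = m every slope is the sign of T, a lift is linear and determined by
-- its value at c₀ modulo n: there are exactly n maps, and for n ≥ 4 no arc joins two of them.
-- If |T| < m, a lift A can always be moved towards any other lift B: at a vertex where A - B is
-- maximal, chosen among those to maximise the potential m L(u) - T u, A can be lowered by one,
-- which decreases the ℓ¹ distance between the two lifts.

open import Data.Nat as ℕ using (ℕ; zero; suc; z≤n; s≤s; _≤_; _<_; _*_; _⊓_; NonZero)
import Data.Nat.Properties as ℕP
open import Data.Nat.Properties using (_≟_)
open import Data.Nat.DivMod using (_%_; m%n<n; m<n⇒m%n≡m; n%n≡0)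
open import Data.Nat.Divisibility using (>⇒∤) renaming (_∣_ to _ℕ∣_)
import Data.Nat.Induction as ℕInd
open import Data.Integer as ℤ using (ℤ; +_; -[1+_]; +[1+_]; +0; ∣_∣; _+_; _-_; -_; 0ℤ; 1ℤ; -1ℤ)
import Data.Integer.Properties as ℤP
open import Data.Integer.DivMod using (_%ℕ_; _/ℕ_; n%ℕd<d; a≡a%ℕn+[a/ℕn]*n)
open import Data.Integer.Divisibility.Signed using (_∣_; divides; ∣m⇒∣-m; ∣m∣n⇒∣m+n; ∣⇒∣ᵤ)
open import Data.Integer.Tactic.RingSolver using (solve-∀)
open import Data.Fin as Fin using (Fin; zero; suc; toℕ; fromℕ<; fromℕ; inject₁)
import Data.Fin.Properties as FinP
open import Data.Fin.Induction using (<-weakInduction)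
open import Data.Fin.Relation.Unary.Top using (view; ‵fromℕ; ‵inject₁; view-inject₁; view-fromℕ)
open import Data.Vec.Functional using (removeAt)
import Data.List as List
import Data.List.Relation.Unary.All as All
open import Data.List.Membership.Propositional.Properties using (∈-allFin)
open import Data.Product using (Σ; _×_; _,_; proj₁; proj₂; uncurry)
open import Data.Product.Relation.Binary.Lex.NonStrict using (×-Lex; ×-totalOrder)
open import Data.Sum as Sum using (_⊎_; inj₁; inj₂)
open import Data.Empty using (⊥; ⊥-elim)
open import Function using (_∘_; id; _on_)
open import Induction.WellFounded using (Acc; acc)
open import Relation.Nullary using (¬_; Dec; yes; no)
open import Relation.Nullary.Decidable using (dec-yes; dec-no)
open import Relation.Binary.Bundles using (TotalOrder)
import Relation.Binary.Construct.On as On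
open import Relation.Binary.Construct.Closure.ReflexiveTransitive using (Star; ε; _◅_; _◅◅_)
open import Relation.Binary.PropositionalEquality
import Algebra.Properties.CommutativeMonoid.Sum
open import Algebra.Properties.CommutativeMonoid.Sum ℤP.+-0-commutativeMonoid
  using (sum; sum-cong-≗; ∑-distrib-+; sum-init-last; sum-remove; sum-replicate-zero)
open import Algebra.Properties.AbelianGroup ℤP.+-0-abelianGroup using (xyx⁻¹≈y; ⁻¹-anti-homo‿-)
open import Defs

data UnitStep : ℤ → Set where
  down : UnitStep -1ℤ
  stay : UnitStep 0ℤ
  up   : UnitStep 1ℤ

unitStep-neg : ∀ {e} → UnitStep e → UnitStep (- e)
unitStep-neg down = up
unitStep-neg stay = stay
unitStep-neg up   = down

∣unitStep∣≤1 : ∀ {e} → UnitStep e → ∣ e ∣ ≤ 1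
∣unitStep∣≤1 down = s≤s z≤n
∣unitStep∣≤1 stay = z≤n
∣unitStep∣≤1 up   = s≤s z≤n

unitStep-suc : ∀ {e} → UnitStep e → e ≢ 1ℤ → UnitStep (e + 1ℤ)
unitStep-suc down _   = stay
unitStep-suc stay _   = up
unitStep-suc up   e≢1 = ⊥-elim (e≢1 refl)

unitStep-pred : ∀ {e} → UnitStep e → e ≢ -1ℤ → UnitStep (e - 1ℤ)
unitStep-pred down e≢-1 = ⊥-elim (e≢-1 refl)
unitStep-pred stay _    = down
unitStep-pred up   _    = stay

unitStep±1⇒0 : ∀ {e} → UnitStep e → UnitStep (e + 1ℤ) → UnitStep (e - 1ℤ) → e ≡ 0ℤ
unitStep±1⇒0 stay _ _ = refl
unitStep±1⇒0 up   () _
unitStep±1⇒0 down _ ()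

data IsSign : ℤ → Set where
  positive : IsSign 1ℤ
  negative : IsSign -1ℤ

isSign⇒unitStep : ∀ {s} → IsSign s → UnitStep s
isSign⇒unitStep positive = up
isSign⇒unitStep negative = down

unitStep±sign⇒0 : ∀ {e s} → IsSign s → UnitStep e → UnitStep (e + s) → UnitStep (e - s) → e ≡ 0ℤ
unitStep±sign⇒0 positive e e+1 e-1 = unitStep±1⇒0 e e+1 e-1
unitStep±sign⇒0 negative e e-1 e+1 = unitStep±1⇒0 e e+1 e-1

∣i∣<n⇒-n<i<n : ∀ {i n} → ∣ i ∣ < n → i ℤ.< + n × - + n ℤ.< i
∣i∣<n⇒-n<i<n {+ _}       {suc _} ∣i∣<n = ℤ.+<+ ∣i∣<n , ℤ.-<+
∣i∣<n⇒-n<i<n { -[1+ _ ]} {suc _} ∣i∣<n = ℤ.-<+ , ℤ.-<- (ℕP.≤-pred ∣i∣<n)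

∣i∣≡n⇒i≡±n : ∀ {i n} → ∣ i ∣ ≡ n → Σ ℤ λ s → IsSign s × i ≡ s ℤ.* + n
∣i∣≡n⇒i≡±n {+ _}       refl = 1ℤ , positive , sym (ℤP.*-identityˡ _)
∣i∣≡n⇒i≡±n { -[1+ _ ]} refl = -1ℤ , negative , sym (ℤP.-1*i≡-i _)

∣i-1∣<∣i∣ : ∀ {i} → 0ℤ ℤ.< i → ∣ i - 1ℤ ∣ < ∣ i ∣
∣i-1∣<∣i∣ {+0}       (ℤ.+<+ ())
∣i-1∣<∣i∣ {+[1+ c ]} _ = subst (_< suc c) (cong ∣_∣ (sym (xyx⁻¹≈y 1ℤ (+ c)))) (ℕP.n<1+n c)

<⇒0<- : ∀ {i j} → i ℤ.< j → 0ℤ ℤ.< j - i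
<⇒0<- {i} {j} i<j = subst (ℤ._< j - i) (ℤP.+-inverseʳ i) (ℤP.+-monoˡ-< (- i) i<j)

rise-contradiction : ∀ {x y d} → y ≡ x + d → 0ℤ ℤ.< d → y ℤ.≤ x → ⊥
rise-contradiction {x} {d = d} refl 0<d x+d≤x =
  ℤP.<⇒≱ (subst (ℤ._< x + d) (ℤP.+-identityʳ x) (ℤP.+-monoʳ-< x 0<d)) x+d≤x

suc-⊓-cases : ∀ j t → suc j ⊓ t ≡ suc (j ⊓ t) ⊎ suc j ⊓ t ≡ j ⊓ t
suc-⊓-cases j t with j ℕP.<? t
... | yes j<t = inj₁ (trans (ℕP.m≤n⇒m⊓n≡m j<t) (cong suc (sym (ℕP.m≤n⇒m⊓n≡m (ℕP.<⇒≤ j<t)))))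
... | no  j≮t = inj₂ (trans (ℕP.m≥n⇒m⊓n≡n (ℕP.m≤n⇒m≤1+n t≤j)) (sym (ℕP.m≥n⇒m⊓n≡n t≤j)))
  where t≤j = ℕP.≮⇒≥ j≮t

sum-neg : ∀ {k} (f : Fin k → ℤ) → sum (λ i → - f i) ≡ - sum f
sum-neg {zero}  f = refl
sum-neg {suc k} f = begin
  (- f zero) + sum (λ i → - f (suc i)) ≡⟨ cong (_+_ (- f zero)) (sum-neg (f ∘ suc)) ⟩
  (- f zero) + (- sum (f ∘ suc))       ≡⟨ ℤP.neg-distrib-+ (f zero) (sum (f ∘ suc)) ⟨
  - (f zero + sum (f ∘ suc))           ∎
  where open ≡-Reasoning

sum-unitSteps-≤ : ∀ {k} (f : Fin k → ℤ) → (∀ i → UnitStep (f i)) → sum f ℤ.≤ + k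
sum-unitSteps-≤ {zero}  f unit = ℤP.≤-refl
sum-unitSteps-≤ {suc k} f unit =
  ℤP.+-mono-≤ (unitStep-≤1 (unit zero)) (sum-unitSteps-≤ (f ∘ suc) (unit ∘ suc))
  where
    unitStep-≤1 : ∀ {e} → UnitStep e → e ℤ.≤ 1ℤ
    unitStep-≤1 down = ℤ.-≤+
    unitStep-≤1 stay = ℤ.+≤+ z≤n
    unitStep-≤1 up   = ℤP.≤-refl

∣sum-unitSteps∣≤ : ∀ {k} (f : Fin k → ℤ) → (∀ i → UnitStep (f i)) → ∣ sum f ∣ ≤ k
∣sum-unitSteps∣≤ {zero}  f unit = z≤n
∣sum-unitSteps∣≤ {suc k} f unit = ℕP.≤-trans (ℤP.∣i+j∣≤∣i∣+∣j∣ (f zero) (sum (f ∘ suc)))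
  (ℕP.+-mono-≤ (∣unitStep∣≤1 (unit zero)) (∣sum-unitSteps∣≤ (f ∘ suc) (unit ∘ suc)))

sum-unitSteps≡k⇒up : ∀ {k} (f : Fin k → ℤ) → (∀ i → UnitStep (f i)) → sum f ≡ + k → ∀ i → f i ≡ 1ℤ
sum-unitSteps≡k⇒up {suc k} f unit Σf≡1+k i =
  up-or-short (unit i) (trans (sym (sum-remove f)) Σf≡1+k)
  where
    rest = sum (removeAt f i)
    rest≤k : rest ℤ.≤ + k
    rest≤k = sum-unitSteps-≤ (removeAt f i) (unit ∘ Fin.punchIn i)
    short : ∀ {e} → e + rest ℤ.≤ + k → e + rest ≢ + suc k
    short ≤k ≡1+k = ℕP.1+n≰n (ℤP.drop‿+≤+ (subst (ℤ._≤ + k) ≡1+k ≤k))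
    up-or-short : ∀ {e} → UnitStep e → e + rest ≡ + suc k → e ≡ 1ℤ
    up-or-short up   _  = refl
    up-or-short stay eq = ⊥-elim (short {0ℤ} (ℤP.+-mono-≤ (ℤ.+≤+ z≤n) rest≤k) eq)
    up-or-short down eq = ⊥-elim (short { -1ℤ} (ℤP.+-mono-≤ ℤ.-≤+ rest≤k) eq)

prefixSum : ∀ {k} → (Fin k → ℤ) → Fin k → ℤ
prefixSum f zero    = 0ℤ
prefixSum f (suc i) = f zero + prefixSum (f ∘ suc) i

prefixSum-suc : ∀ {k} (f : Fin (suc k) → ℤ) (j : Fin k) →
  prefixSum f (suc j) ≡ prefixSum f (inject₁ j) + f (inject₁ j)
prefixSum-suc f zero    = ℤP.+-comm (f zero) 0ℤ
prefixSum-suc f (suc j) = begin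
  f zero + prefixSum (f ∘ suc) (suc j)                             ≡⟨ cong (_+_ (f zero)) (prefixSum-suc (f ∘ suc) j) ⟩
  f zero + (prefixSum (f ∘ suc) (inject₁ j) + f (suc (inject₁ j))) ≡⟨ ℤP.+-assoc (f zero) _ _ ⟨
  f zero + prefixSum (f ∘ suc) (inject₁ j) + f (suc (inject₁ j))   ∎
  where open ≡-Reasoning

sum-prefixSum : ∀ {k} (f : Fin (suc k) → ℤ) → sum f ≡ prefixSum f (fromℕ k) + f (fromℕ k)
sum-prefixSum {zero}  f = ℤP.+-comm (f zero) 0ℤ
sum-prefixSum {suc k} f = begin
  f zero + sum (f ∘ suc)                                       ≡⟨ cong (_+_ (f zero)) (sum-prefixSum (f ∘ suc)) ⟩
  f zero + (prefixSum (f ∘ suc) (fromℕ k) + f (suc (fromℕ k))) ≡⟨ ℤP.+-assoc (f zero) _ _ ⟨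
  f zero + prefixSum (f ∘ suc) (fromℕ k) + f (suc (fromℕ k))   ∎
  where open ≡-Reasoning

module ℕΣ = Algebra.Properties.CommutativeMonoid.Sum ℕP.+-0-commutativeMonoid

ℕsum-mono-≤ : ∀ {k} (f g : Fin k → ℕ) → (∀ i → f i ≤ g i) → ℕΣ.sum f ≤ ℕΣ.sum g
ℕsum-mono-≤ {zero}  f g f≤g = z≤n
ℕsum-mono-≤ {suc k} f g f≤g = ℕP.+-mono-≤ (f≤g zero) (ℕsum-mono-≤ (f ∘ suc) (g ∘ suc) (f≤g ∘ suc))

ℕsum-mono-< : ∀ {k} (f g : Fin k → ℕ) → (∀ i → f i ≤ g i) → ∀ p → f p < g p → ℕΣ.sum f < ℕΣ.sum g
ℕsum-mono-< {suc k} f g f≤g zero    fp<gp =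
  ℕP.+-mono-<-≤ fp<gp (ℕsum-mono-≤ (f ∘ suc) (g ∘ suc) (f≤g ∘ suc))
ℕsum-mono-< {suc k} f g f≤g (suc p) fp<gp =
  ℕP.+-mono-≤-< (f≤g zero) (ℕsum-mono-< (f ∘ suc) (g ∘ suc) (f≤g ∘ suc) p fp<gp)

module _ {a ℓ₁ ℓ₂} (O : TotalOrder a ℓ₁ ℓ₂) where
  open TotalOrder O using (Carrier) renaming (_≤_ to _≼_)
  open import Data.List.Extrema O using (argmax; f[xs]≤f[argmax])

  maximiser : ∀ {k} (f : Fin (suc k) → Carrier) → Σ (Fin (suc k)) λ p → ∀ v → f v ≼ f p
  maximiser f = argmax f zero (List.allFin _)
              , λ v → All.lookup (f[xs]≤f[argmax] zero (List.allFin _)) (∈-allFin v)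

last-or-inject₁ : ∀ {k} {P : Fin (suc k) → Set} → P (fromℕ k) → (∀ j → P (inject₁ j)) → ∀ i → P i
last-or-inject₁ last inner i with view i
... | ‵fromℕ     = last
... | ‵inject₁ j = inner j

Step-functional : ∀ {k a b c} → Step k a b → Step k a c → b ≡ c
Step-functional         (inj₁ p)       (inj₁ q)       = FinP.toℕ-injective (trans (sym p) q)
Step-functional {b = b} (inj₁ p)       (inj₂ (q , _)) = ⊥-elim (ℕP.<-irrefl (trans (sym p) q) (FinP.toℕ<n b))
Step-functional {c = c} (inj₂ (q , _)) (inj₁ p)       = ⊥-elim (ℕP.<-irrefl (trans (sym p) q) (FinP.toℕ<n c))
Step-functional         (inj₂ (_ , p)) (inj₂ (_ , q)) = FinP.toℕ-injective (trans p (sym q))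

Step-injective : ∀ {k a b c} → Step k a c → Step k b c → a ≡ b
Step-injective (inj₁ p)       (inj₁ q)       = FinP.toℕ-injective (ℕP.suc-injective (trans p (sym q)))
Step-injective (inj₁ p)       (inj₂ (_ , q)) with () ← trans p q
Step-injective (inj₂ (_ , q)) (inj₁ p)       with () ← trans p q
Step-injective (inj₂ (p , _)) (inj₂ (q , _)) = FinP.toℕ-injective (ℕP.suc-injective (trans p (sym q)))

Arc-sym : ∀ {k a b} → Arc k a b → Arc k b a
Arc-sym (inj₁ refl)      = inj₁ refl
Arc-sym (inj₂ (inj₁ s)) = inj₂ (inj₂ s)
Arc-sym (inj₂ (inj₂ s)) = inj₂ (inj₁ s)

toℕ-next : ∀ {k} (u : Fin (suc k)) → toℕ (next u) ≡ suc (toℕ u) % suc k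
toℕ-next {k} u = FinP.toℕ-fromℕ< (m%n<n (suc (toℕ u)) (suc k))

Step⇒≡next : ∀ {k} {u v : Fin (suc k)} → Step (suc k) u v → v ≡ next u
Step⇒≡next {k} {u} {v} step = FinP.toℕ-injective (trans (toℕ-v step) (sym (toℕ-next u)))
  where
    toℕ-v : Step (suc k) u v → toℕ v ≡ suc (toℕ u) % suc k
    toℕ-v (inj₁ u+1≡v)         = sym (trans (cong (_% suc k) u+1≡v) (m<n⇒m%n≡m (FinP.toℕ<n v)))
    toℕ-v (inj₂ (u+1≡n , v≡0)) = trans v≡0 (sym (trans (cong (_% suc k) u+1≡n) (n%n≡0 (suc k))))

Step-next : ∀ {k} (u : Fin (suc k)) → Step (suc k) u (next u)
Step-next {k} u with suc (toℕ u) ℕP.<? suc k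
... | yes u+1<n = inj₁ (sym (trans (toℕ-next u) (m<n⇒m%n≡m u+1<n)))
... | no  u+1≮n = inj₂ (u+1≡n , trans (toℕ-next u) (trans (cong (_% suc k) u+1≡n) (n%n≡0 (suc k))))
  where
    u+1≡n : suc (toℕ u) ≡ suc k
    u+1≡n = ℕP.≤-antisym (FinP.toℕ<n u) (ℕP.≮⇒≥ u+1≮n)

Arc-cases : ∀ {k} {u v : Fin (suc k)} → Arc (suc k) u v → v ≡ u ⊎ v ≡ next u ⊎ u ≡ next v
Arc-cases (inj₁ u≡v)        = inj₁ (sym u≡v)
Arc-cases (inj₂ (inj₁ u→v)) = inj₂ (inj₁ (Step⇒≡next u→v))
Arc-cases (inj₂ (inj₂ v→u)) = inj₂ (inj₂ (Step⇒≡next v→u))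

next-inject₁ : ∀ {k} (j : Fin k) → next (inject₁ j) ≡ suc j
next-inject₁ {k} j = FinP.toℕ-injective (begin
  toℕ (next (inject₁ j))        ≡⟨ toℕ-next (inject₁ j) ⟩
  suc (toℕ (inject₁ j)) % suc k ≡⟨ cong (λ t → suc t % suc k) (FinP.toℕ-inject₁ j) ⟩
  suc (toℕ j) % suc k           ≡⟨ m<n⇒m%n≡m (s≤s (FinP.toℕ<n j)) ⟩
  suc (toℕ j)                   ∎)
  where open ≡-Reasoning

next-fromℕ : ∀ k → next (fromℕ k) ≡ zero
next-fromℕ k = FinP.toℕ-injective (begin
  toℕ (next (fromℕ k))        ≡⟨ toℕ-next (fromℕ k) ⟩
  suc (toℕ (fromℕ k)) % suc k ≡⟨ cong (λ t → suc t % suc k) (FinP.toℕ-fromℕ k) ⟩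
  suc k % suc k               ≡⟨ n%n≡0 (suc k) ⟩
  0                           ∎)
  where open ≡-Reasoning

next≢id : ∀ {k} (u : Fin (suc (suc k))) → next u ≢ u
next≢id u next-u≡u with Step-next u
... | inj₁ u+1≡next-u         = ℕP.1+n≢n (trans u+1≡next-u (cong toℕ next-u≡u))
... | inj₂ (u+1≡n , next-u≡0) with () ← trans (sym (cong suc (trans (cong toℕ (sym next-u≡u)) next-u≡0))) u+1≡n

sum-∘next : ∀ {k} (f : Fin (suc k) → ℤ) → sum (f ∘ next) ≡ sum f
sum-∘next {k} f = begin
  sum (f ∘ next)                                ≡⟨ sum-init-last (f ∘ next) ⟩
  sum (f ∘ next ∘ inject₁) + f (next (fromℕ k)) ≡⟨ cong₂ _+_ (sum-cong-≗ (cong f ∘ next-inject₁)) (cong f (next-fromℕ k)) ⟩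
  sum (f ∘ suc) + f zero                        ≡⟨ ℤP.+-comm (sum (f ∘ suc)) (f zero) ⟩
  sum f                                         ∎
  where open ≡-Reasoning

-- The lift of a map C → D lives on the path c₀ … c_{m-1}; crossing the closing edge c_{m-1} c₀
-- its height jumps by the total increase T, which atLast T records.
atLast : ∀ {k} → ℤ → Fin (suc k) → ℤ
atLast T i with view i
... | ‵fromℕ     = T
... | ‵inject₁ _ = 0ℤ

atLast-inject₁ : ∀ {k} T (j : Fin k) → atLast T (inject₁ j) ≡ 0ℤ
atLast-inject₁ T j rewrite view-inject₁ j = refl

atLast-fromℕ : ∀ {k} T → atLast T (fromℕ k) ≡ T
atLast-fromℕ {k} T rewrite view-fromℕ k = refl

atLast-cases : ∀ {k} T (i : Fin (suc k)) → atLast T i ≡ 0ℤ ⊎ atLast T i ≡ T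
atLast-cases T = last-or-inject₁ (inj₂ (atLast-fromℕ T)) (inj₁ ∘ atLast-inject₁ T)

sum-atLast : ∀ {k} T → sum (atLast {k} T) ≡ T
sum-atLast {k} T = begin
  sum (atLast {k} T)                                 ≡⟨ sum-init-last (atLast {k} T) ⟩
  sum (atLast {k} T ∘ inject₁) + atLast T (fromℕ k)  ≡⟨ cong₂ _+_ (sum-cong-≗ (atLast-inject₁ {k} T)) (atLast-fromℕ T) ⟩
  sum {k} (λ _ → 0ℤ) + T                             ≡⟨ cong (_+ T) (sum-replicate-zero k) ⟩
  0ℤ + T                                             ≡⟨ ℤP.+-identityˡ T ⟩
  T                                                  ∎
  where open ≡-Reasoning

increase-≡-sum : ∀ {m n} (φ : Hom m n) → increase φ ≡ sum (λ i → delta n (proj₁ φ i) (proj₁ φ (next i)))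
increase-≡-sum {m} {n} (f , _) = foldr-tabulate id
  where
    foldr-tabulate : ∀ {k} (g : Fin k → Fin m) →
      List.foldr (λ i acc → delta n (f i) (f (next i)) + acc) 0ℤ (List.tabulate g)
        ≡ sum (λ i → delta n (f (g i)) (f (next (g i))))
    foldr-tabulate {zero}  g = refl
    foldr-tabulate {suc k} g = cong (_+_ (delta n (f (g zero)) (f (next (g zero))))) (foldr-tabulate (g ∘ suc))

module Congruence (n : ℕ) .{{_ : NonZero n}} where

  infix 4 _≈_
  record _≈_ (x y : ℤ) : Set where
    constructor ≈-intro
    field n∣x-y : + n ∣ x - y

  ≈-sym : ∀ {x y} → x ≈ y → y ≈ x
  ≈-sym {x} {y} (≈-intro n∣x-y) = ≈-intro (subst (+ n ∣_) (⁻¹-anti-homo‿- x y) (∣m⇒∣-m n∣x-y))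

  ≈-trans : ∀ {x y z} → x ≈ y → y ≈ z → x ≈ z
  ≈-trans {x} {y} {z} (≈-intro n∣x-y) (≈-intro n∣y-z) =
    ≈-intro (subst (+ n ∣_) (ℤP.+-minus-telescope x y z) (∣m∣n⇒∣m+n n∣x-y n∣y-z))

  ≈-+ʳ : ∀ {x y} z → x ≈ y → x + z ≈ y + z
  ≈-+ʳ {x} {y} z (≈-intro n∣x-y) = ≈-intro (subst (+ n ∣_) (sym (minus-cancelʳ x y z)) n∣x-y)
    where
      minus-cancelʳ : ∀ x y z → (x + z) - (y + z) ≡ x - y
      minus-cancelʳ = solve-∀

  ≈-cancelˡ : ∀ a {x y} → a + x ≈ a + y → x ≈ y
  ≈-cancelˡ a {x} {y} (≈-intro n∣a+x-[a+y]) = ≈-intro (subst (+ n ∣_) (minus-cancelˡ a x y) n∣a+x-[a+y])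
    where
      minus-cancelˡ : ∀ a x y → (a + x) - (a + y) ≡ x - y
      minus-cancelˡ = solve-∀

  +-multiple-≈ : ∀ x q → x + q ℤ.* + n ≈ x
  +-multiple-≈ x q = ≈-intro (divides q (xyx⁻¹≈y x (q ℤ.* + n)))

  ≈⇒≡ : ∀ {x y} → x ≈ y → ∣ x - y ∣ < n → x ≡ y
  ≈⇒≡ {x} {y} (≈-intro n∣x-y) ∣x-y∣<n with ∣ x - y ∣ in eq
  ... | zero  = ℤP.i-j≡0⇒i≡j x y (ℤP.∣i∣≡0⇒i≡0 eq)
  ... | suc _ = ⊥-elim (>⇒∤ ∣x-y∣<n (subst (n ℕ∣_) eq (∣⇒∣ᵤ n∣x-y)))

  ≈⇒≡-below : ∀ {r s} → r < n → s < n → + r ≈ + s → r ≡ s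
  ≈⇒≡-below {r} {s} r<n s<n r≈s = ℤP.+-injective (≈⇒≡ r≈s ∣r-s∣<n)
    where
      ∣r-s∣<n : ∣ + r - + s ∣ < n
      ∣r-s∣<n rewrite ℤP.m-n≡m⊖n r s = ℕP.≤-<-trans (ℤP.∣m⊝n∣≤m⊔n r s) (ℕP.⊔-lub r<n s<n)

  residue : ℤ → Fin n
  residue x = fromℕ< (n%ℕd<d x n)

  ≈-residue : ∀ x → x ≈ + toℕ (residue x)
  ≈-residue x = ≈-intro (divides (x /ℕ n) (begin
    x - + toℕ (residue x)                        ≡⟨ cong (λ r → x - + r) (FinP.toℕ-fromℕ< (n%ℕd<d x n)) ⟩
    x - + (x %ℕ n)                               ≡⟨ cong (_- + (x %ℕ n)) (a≡a%ℕn+[a/ℕn]*n x n) ⟩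
    (+ (x %ℕ n) + (x /ℕ n) ℤ.* + n) - + (x %ℕ n) ≡⟨ xyx⁻¹≈y (+ (x %ℕ n)) ((x /ℕ n) ℤ.* + n) ⟩
    (x /ℕ n) ℤ.* + n                             ∎))
    where open ≡-Reasoning

  residue-cong : ∀ {x y} → x ≈ y → residue x ≡ residue y
  residue-cong {x} {y} x≈y = FinP.toℕ-injective
    (≈⇒≡-below (FinP.toℕ<n (residue x)) (FinP.toℕ<n (residue y))
      (≈-trans (≈-sym (≈-residue x)) (≈-trans x≈y (≈-residue y))))

  residue-≈ : ∀ {x y} → residue x ≡ residue y → x ≈ y
  residue-≈ {x} {y} eq =
    ≈-trans (≈-residue x) (subst (λ a → + toℕ a ≈ y) (sym eq) (≈-sym (≈-residue y)))

  toℕ-residue : ∀ {r} → r < n → toℕ (residue (+ r)) ≡ r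
  toℕ-residue {r} r<n = ≈⇒≡-below (FinP.toℕ<n (residue (+ r))) r<n (≈-sym (≈-residue (+ r)))

  residue-toℕ : ∀ a → residue (+ toℕ a) ≡ a
  residue-toℕ a = FinP.toℕ-injective (toℕ-residue (FinP.toℕ<n a))

  residue-suc : ∀ x → Step n (residue x) (residue (x + 1ℤ))
  residue-suc x with suc (toℕ (residue x)) ℕP.<? n
  ... | yes r+1<n = inj₁ (sym (trans (cong toℕ (residue-cong x+1≈r+1)) (toℕ-residue r+1<n)))
    where
      x+1≈r+1 : x + 1ℤ ≈ + suc (toℕ (residue x))
      x+1≈r+1 = subst (x + 1ℤ ≈_) (ℤP.+-comm (+ toℕ (residue x)) 1ℤ) (≈-+ʳ 1ℤ (≈-residue x))
  ... | no r+1≮n = inj₂ (r+1≡n , trans (cong toℕ (residue-cong x+1≈0)) (toℕ-residue (ℕ.>-nonZero⁻¹ n)))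
    where
      r+1≡n : suc (toℕ (residue x)) ≡ n
      r+1≡n = ℕP.≤-antisym (FinP.toℕ<n (residue x)) (ℕP.≮⇒≥ r+1≮n)
      n≈0 : + n ≈ 0ℤ
      n≈0 = subst (_≈ 0ℤ) (trans (ℤP.+-identityˡ _) (ℤP.*-identityˡ (+ n))) (+-multiple-≈ 0ℤ 1ℤ)
      x+1≈0 : x + 1ℤ ≈ 0ℤ
      x+1≈0 = ≈-trans (≈-+ʳ 1ℤ (≈-residue x))
                (subst (_≈ 0ℤ) (cong +_ (trans (sym r+1≡n) (ℕP.+-comm 1 _))) n≈0)

  residue-pred : ∀ x → Step n (residue (x - 1ℤ)) (residue x)
  residue-pred x = subst (λ y → Step n (residue (x - 1ℤ)) (residue y)) (minus-plus x) (residue-suc (x - 1ℤ))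
    where
      minus-plus : ∀ x → x - 1ℤ + 1ℤ ≡ x
      minus-plus = solve-∀

  residue-arc : ∀ x {e} → UnitStep e → Arc n (residue x) (residue (x + e))
  residue-arc x down = inj₂ (inj₂ (residue-pred x))
  residue-arc x stay = inj₁ (cong residue (sym (ℤP.+-identityʳ x)))
  residue-arc x up   = inj₂ (inj₁ (residue-suc x))

  residue-arc-unitStep : ∀ x y → UnitStep (y - x) → Arc n (residue x) (residue y)
  residue-arc-unitStep x y y-x = subst (Arc n (residue x) ∘ residue) (plus-minus x y) (residue-arc x y-x)
    where
      plus-minus : ∀ x y → x + (y - x) ≡ y
      plus-minus = solve-∀

module ArcLifting (k : ℕ) where

  n : ℕ
  n = suc (suc (suc k))

  open Congruence n public

  private
    toℕ≡0⇒≢suc : ∀ {a} {b : Fin n} → toℕ b ≡ 0 → suc a ≢ toℕ b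
    toℕ≡0⇒≢suc b≡0 eq = ℕP.1+n≢0 (trans eq b≡0)

    1≢n : 1 ≢ n
    1≢n ()

    last≢1 : ∀ {a : Fin n} → suc (toℕ a) ≡ n → 1 ≢ toℕ a
    last≢1 a+1≡n eq with () ← trans (cong suc eq) a+1≡n

  delta-forward : ∀ {a b} → Step n a b → delta n a b ≡ 1ℤ
  delta-forward {a} {b} (inj₁ a+1≡b)
    rewrite proj₂ (dec-yes (suc (toℕ a) ≟ toℕ b) a+1≡b) = refl
  delta-forward {a} {b} (inj₂ (a+1≡n , b≡0))
    rewrite dec-no (suc (toℕ a) ≟ toℕ b) (toℕ≡0⇒≢suc b≡0)
          | dec-no (suc (toℕ b) ≟ toℕ a) (λ eq → last≢1 a+1≡n (trans (cong suc (sym b≡0)) eq))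
          | proj₂ (dec-yes (suc (toℕ a) ≟ n) a+1≡n)
          | proj₂ (dec-yes (toℕ b ≟ 0) b≡0) = refl

  delta-backward : ∀ {a b} → Step n b a → delta n a b ≡ -1ℤ
  delta-backward {a} {b} (inj₁ b+1≡a)
    rewrite dec-no (suc (toℕ a) ≟ toℕ b) (λ eq → ℕP.m≢1+n+m (toℕ b) (sym (trans (cong suc b+1≡a) eq)))
          | proj₂ (dec-yes (suc (toℕ b) ≟ toℕ a) b+1≡a) = refl
  delta-backward {a} {b} (inj₂ (b+1≡n , a≡0))
    rewrite dec-no (suc (toℕ a) ≟ toℕ b) (λ eq → last≢1 b+1≡n (trans (cong suc (sym a≡0)) eq))
          | dec-no (suc (toℕ b) ≟ toℕ a) (toℕ≡0⇒≢suc a≡0)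
          | dec-no (suc (toℕ a) ≟ n) (λ eq → 1≢n (trans (cong suc (sym a≡0)) eq))
          | proj₂ (dec-yes (suc (toℕ b) ≟ n) b+1≡n)
          | proj₂ (dec-yes (toℕ a ≟ 0) a≡0) = refl

  delta-loop : ∀ a → delta n a a ≡ 0ℤ
  delta-loop a with suc (toℕ a) ≟ toℕ a
  ... | yes a+1≡a = ⊥-elim (ℕP.1+n≢n a+1≡a)
  ... | no _ with suc (toℕ a) ≟ toℕ a
  ...   | yes a+1≡a = ⊥-elim (ℕP.1+n≢n a+1≡a)
  ...   | no _ with suc (toℕ a) ≟ n | toℕ a ≟ 0
  ...     | yes a+1≡n | yes a≡0 = ⊥-elim (1≢n (trans (cong suc (sym a≡0)) a+1≡n))
  ...     | yes _ | no _ with suc (toℕ a) ≟ n | toℕ a ≟ 0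
  ...       | yes a+1≡n | yes a≡0 = ⊥-elim (1≢n (trans (cong suc (sym a≡0)) a+1≡n))
  ...       | yes _ | no _ = refl
  ...       | no _ | _ = refl
  delta-loop a | no _ | no _ | no _ | _ with suc (toℕ a) ≟ n | toℕ a ≟ 0
  ...       | yes a+1≡n | yes a≡0 = ⊥-elim (1≢n (trans (cong suc (sym a≡0)) a+1≡n))
  ...       | yes _ | no _ = refl
  ...       | no _ | _ = refl

  delta-unitStep : ∀ a b → UnitStep (delta n a b)
  delta-unitStep a b with suc (toℕ a) ≟ toℕ b
  ... | yes _ = up
  ... | no _ with suc (toℕ b) ≟ toℕ a
  ...   | yes _ = down
  ...   | no _ with suc (toℕ a) ≟ n | toℕ b ≟ 0
  ...     | yes _ | yes _ = up
  ...     | yes _ | no _ with suc (toℕ b) ≟ n | toℕ a ≟ 0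
  ...       | yes _ | yes _ = down
  ...       | yes _ | no _ = stay
  ...       | no _ | _ = stay
  delta-unitStep a b | no _ | no _ | no _ | _ with suc (toℕ b) ≟ n | toℕ a ≟ 0
  ...       | yes _ | yes _ = down
  ...       | yes _ | no _ = stay
  ...       | no _ | _ = stay

  delta-residue : ∀ x {e} → UnitStep e → delta n (residue x) (residue (x + e)) ≡ e
  delta-residue x down = delta-backward (residue-pred x)
  delta-residue x stay rewrite ℤP.+-identityʳ x = delta-loop (residue x)
  delta-residue x up   = delta-forward (residue-suc x)

  residue-+-delta : ∀ x {a b} → Arc n a b → residue x ≡ a → residue (x + delta n a b) ≡ b
  residue-+-delta x {a} (inj₁ refl) refl rewrite delta-loop a | ℤP.+-identityʳ x = refl
  residue-+-delta x {a} {b} (inj₂ (inj₁ a→b)) refl rewrite delta-forward a→b =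
    Step-functional (residue-suc x) a→b
  residue-+-delta x {a} {b} (inj₂ (inj₂ b→a)) refl rewrite delta-backward b→a =
    Step-injective (residue-pred x) b→a

  Arc⇒≈ : ∀ x y → Arc n (residue x) (residue y) → Σ ℤ λ e → UnitStep e × x + e ≈ y
  Arc⇒≈ x y arc = delta n (residue x) (residue y) , delta-unitStep (residue x) (residue y)
                , residue-≈ (residue-+-delta x arc refl)

module Lifts (m' k : ℕ) (w : ℤ) where

  open ArcLifting k public

  m : ℕ
  m = suc m'

  T : ℤ
  T = w ℤ.* + n

  jump : Fin m → ℤ
  jump = atLast T

  slope : (Fin m → ℤ) → Fin m → ℤ
  slope L i = L (next i) + jump i - L i

  record Lift : Set where
    constructor mkLift
    field
      height     : Fin m → ℤ
      slope-unit : ∀ i → UnitStep (slope height i)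
  open Lift public

  slope-inject₁ : ∀ L (j : Fin m') → slope L (inject₁ j) ≡ L (suc j) - L (inject₁ j)
  slope-inject₁ L j = trans (cong₂ (λ u t → L u + t - L (inject₁ j)) (next-inject₁ j) (atLast-inject₁ T j))
                            (cong (_- L (inject₁ j)) (ℤP.+-identityʳ (L (suc j))))

  slope-fromℕ : ∀ L → slope L (fromℕ m') ≡ L zero + T - L (fromℕ m')
  slope-fromℕ L = cong₂ (λ u t → L u + t - L (fromℕ m')) (next-fromℕ m') (atLast-fromℕ T)

  sum-slope : ∀ L → sum (slope L) ≡ T
  sum-slope L = begin
    sum (λ i → L (next i) + jump i - L i)               ≡⟨ ∑-distrib-+ (λ i → L (next i) + jump i) (λ i → - L i) ⟩
    sum (λ i → L (next i) + jump i) + sum (λ i → - L i) ≡⟨ cong₂ _+_ (∑-distrib-+ (L ∘ next) jump) (sum-neg L) ⟩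
    sum (L ∘ next) + sum jump - sum L                   ≡⟨ cong₂ (λ a b → a + b - sum L) (sum-∘next L) (sum-atLast {m'} T) ⟩
    sum L + T - sum L                                   ≡⟨ xyx⁻¹≈y (sum L) T ⟩
    T                                                   ∎
    where open ≡-Reasoning

  residue-+-jump : ∀ x (i : Fin m) → residue (x + jump i) ≡ residue x
  residue-+-jump x i with jump i | atLast-cases T i
  ... | _ | inj₁ refl = cong residue (ℤP.+-identityʳ x)
  ... | _ | inj₂ refl = residue-cong (+-multiple-≈ x w)

  -- Every arc u → v of C goes from L u to L′ v by a unit step (plus the jump across the closing edge).
  Close : (Fin m → ℤ) → (Fin m → ℤ) → Set
  Close L L′ = (∀ u → UnitStep (L′ u - L u))
             × (∀ u → UnitStep (L′ (next u) + jump u - L u))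
             × (∀ u → UnitStep (L (next u) + jump u - L′ u))

  Close-refl : ∀ A → Close (height A) (height A)
  Close-refl A = (λ u → subst UnitStep (sym (ℤP.+-inverseʳ (height A u))) stay)
               , slope-unit A , slope-unit A

  Close⇒HArc : ∀ {L L′} → Close L L′ → ∀ u v → Arc m u v → Arc n (residue (L u)) (residue (L′ v))
  Close⇒HArc {L} {L′} (vertical , forward , backward) u v arc with Arc-cases arc
  ... | inj₁ refl        = residue-arc-unitStep (L u) (L′ u) (vertical u)
  ... | inj₂ (inj₁ refl) = subst (Arc n (residue (L u))) (residue-+-jump (L′ (next u)) u)
                                 (residue-arc-unitStep (L u) (L′ (next u) + jump u) (forward u))
  ... | inj₂ (inj₂ refl) = Arc-sym (subst (Arc n (residue (L′ v))) (residue-+-jump (L (next v)) v)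
                                          (residue-arc-unitStep (L′ v) (L (next v) + jump v) (backward v)))

  delta-slope : ∀ A i → delta n (residue (height A i)) (residue (height A (next i))) ≡ slope (height A) i
  delta-slope A i = begin
    delta n (residue (L i)) (residue (L (next i)))
      ≡⟨ cong (delta n (residue (L i))) (residue-+-jump (L (next i)) i) ⟨
    delta n (residue (L i)) (residue (L (next i) + jump i))
      ≡⟨ cong (delta n (residue (L i)) ∘ residue) (plus-minus (L i) (L (next i) + jump i)) ⟨
    delta n (residue (L i)) (residue (L i + slope L i))
      ≡⟨ delta-residue (L i) (slope-unit A i) ⟩
    slope L i
      ∎
    where
      open ≡-Reasoning
      L = height A
      plus-minus : ∀ x y → x + (y - x) ≡ y
      plus-minus = solve-∀

  project : Lift → HomW m n w
  project A = hom , trans (increase-≡-sum hom) (trans (sum-cong-≗ (delta-slope A)) (sum-slope (height A)))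
    where
      hom : Hom m n
      hom = residue ∘ height A , Close⇒HArc {height A} (Close-refl A)

  ∣T∣≤m : HomW m n w → ∣ T ∣ ≤ m
  ∣T∣≤m ((f , hom) , increase≡T) =
    subst (_≤ m) (cong ∣_∣ sum≡T) (∣sum-unitSteps∣≤ _ λ i → delta-unitStep (f i) (f (next i)))
    where
      sum≡T : sum (λ i → delta n (f i) (f (next i))) ≡ T
      sum≡T = trans (sym (increase-≡-sum (f , hom))) increase≡T

  ramp : ∀ {s} t → UnitStep s → t ≤ m' → T ≡ s ℤ.* + t → Lift
  ramp {s} t s-unit t≤m' T≡st = mkLift L (last-or-inject₁ (subst UnitStep (sym flat-last) stay) rising-or-flat)
    where
      open ≡-Reasoning
      L : Fin m → ℤ
      L u = s ℤ.* + (toℕ u ⊓ t)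
      flat-last : slope L (fromℕ m') ≡ 0ℤ
      flat-last = begin
        slope L (fromℕ m')                                ≡⟨ slope-fromℕ L ⟩
        s ℤ.* 0ℤ + T - s ℤ.* + (toℕ (fromℕ m') ⊓ t)
          ≡⟨ cong₂ (λ T′ l → s ℤ.* 0ℤ + T′ - s ℤ.* + (l ⊓ t)) T≡st (FinP.toℕ-fromℕ m') ⟩
        s ℤ.* 0ℤ + s ℤ.* + t - s ℤ.* + (m' ⊓ t)
          ≡⟨ cong (λ l → s ℤ.* 0ℤ + s ℤ.* + t - s ℤ.* + l) (ℕP.m≥n⇒m⊓n≡n t≤m') ⟩
        s ℤ.* 0ℤ + s ℤ.* + t - s ℤ.* + t                  ≡⟨ cancel s (+ t) ⟩
        0ℤ                                                ∎
        where
          cancel : ∀ s t → s ℤ.* 0ℤ + s ℤ.* t - s ℤ.* t ≡ 0ℤ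
          cancel = solve-∀
      rising-or-flat : ∀ j → UnitStep (slope L (inject₁ j))
      rising-or-flat j with suc-⊓-cases (toℕ j) t
      ... | inj₁ rises = subst UnitStep (sym (trans (slope-inject₁ L j) (begin
        s ℤ.* + (suc (toℕ j) ⊓ t) - s ℤ.* + (toℕ (inject₁ j) ⊓ t)
          ≡⟨ cong₂ (λ a b → s ℤ.* + a - s ℤ.* + (b ⊓ t)) rises (FinP.toℕ-inject₁ j) ⟩
        s ℤ.* (1ℤ + + (toℕ j ⊓ t)) - s ℤ.* + (toℕ j ⊓ t)  ≡⟨ difference s (+ (toℕ j ⊓ t)) ⟩
        s                                                 ∎))) s-unit
        where
          difference : ∀ s x → s ℤ.* (1ℤ + x) - s ℤ.* x ≡ s
          difference = solve-∀
      ... | inj₂ stays = subst UnitStep (sym (trans (slope-inject₁ L j) (begin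
        s ℤ.* + (suc (toℕ j) ⊓ t) - s ℤ.* + (toℕ (inject₁ j) ⊓ t)
          ≡⟨ cong₂ (λ a b → s ℤ.* + a - s ℤ.* + (b ⊓ t)) stays (FinP.toℕ-inject₁ j) ⟩
        s ℤ.* + (toℕ j ⊓ t) - s ℤ.* + (toℕ j ⊓ t)         ≡⟨ ℤP.+-inverseʳ (s ℤ.* + (toℕ j ⊓ t)) ⟩
        0ℤ                                                ∎))) stay

  Lift-exists : ∣ T ∣ < m → Lift
  Lift-exists = by-sign T refl
    where
      by-sign : ∀ x → x ≡ T → ∣ x ∣ < m → Lift
      by-sign (+ t)    x≡T (s≤s t≤m') = ramp t up t≤m' (trans (sym x≡T) (sym (ℤP.*-identityˡ (+ t))))
      by-sign -[1+ t ] x≡T (s≤s t≤m') = ramp (suc t) down t≤m' (trans (sym x≡T) (sym (ℤP.-1*i≡-i (+ suc t))))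

  slope-prefixSum : ∀ b (δ : Fin m → ℤ) → sum δ ≡ T → ∀ i → slope (λ u → b + prefixSum δ u) i ≡ δ i
  slope-prefixSum b δ Σδ≡T = last-or-inject₁ last inner
    where
      open ≡-Reasoning
      L : Fin m → ℤ
      L u = b + prefixSum δ u
      last : slope L (fromℕ m') ≡ δ (fromℕ m')
      last = begin
        slope L (fromℕ m')                               ≡⟨ slope-fromℕ L ⟩
        b + 0ℤ + T - L (fromℕ m')                        ≡⟨ cong (λ t → b + 0ℤ + t - L (fromℕ m')) (trans (sym Σδ≡T) (sum-prefixSum δ)) ⟩
        b + 0ℤ + (prefixSum δ (fromℕ m') + δ (fromℕ m')) - (b + prefixSum δ (fromℕ m'))
          ≡⟨ telescope b (prefixSum δ (fromℕ m')) (δ (fromℕ m')) ⟩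
        δ (fromℕ m')                                     ∎
        where
          telescope : ∀ b p d → b + 0ℤ + (p + d) - (b + p) ≡ d
          telescope = solve-∀
      inner : ∀ j → slope L (inject₁ j) ≡ δ (inject₁ j)
      inner j = begin
        slope L (inject₁ j)                               ≡⟨ slope-inject₁ L j ⟩
        b + prefixSum δ (suc j) - L (inject₁ j)           ≡⟨ cong (λ p → b + p - L (inject₁ j)) (prefixSum-suc δ j) ⟩
        b + (prefixSum δ (inject₁ j) + δ (inject₁ j)) - (b + prefixSum δ (inject₁ j))
          ≡⟨ telescope b (prefixSum δ (inject₁ j)) (δ (inject₁ j)) ⟩
        δ (inject₁ j)                                     ∎
        where
          telescope : ∀ b p d → b + (p + d) - (b + p) ≡ d
          telescope = solve-∀

  edgeIncrease : HomW m n w → Fin m → ℤ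
  edgeIncrease ((f , _) , _) i = delta n (f i) (f (next i))

  liftHeight : HomW m n w → Fin m → ℤ
  liftHeight φ u = + toℕ (proj₁ (proj₁ φ) zero) + prefixSum (edgeIncrease φ) u

  liftHom : HomW m n w → Lift
  liftHom φ@((f , hom) , increase≡T) = mkLift (liftHeight φ) λ i →
    subst UnitStep (sym (slope-prefixSum (+ toℕ (f zero)) (edgeIncrease φ) sum-edgeIncrease i))
          (delta-unitStep (f i) (f (next i)))
    where
      sum-edgeIncrease : sum (edgeIncrease φ) ≡ T
      sum-edgeIncrease = trans (sym (increase-≡-sum (f , hom))) increase≡T

  residue-liftHeight : ∀ φ u → residue (liftHeight φ u) ≡ proj₁ (proj₁ φ) u
  residue-liftHeight φ@((f , hom) , _) = <-weakInduction (λ u → residue (liftHeight φ u) ≡ f u) base step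
    where
      b = + toℕ (f zero)
      δ = edgeIncrease φ
      base : residue (b + 0ℤ) ≡ f zero
      base = trans (cong residue (ℤP.+-identityʳ b)) (residue-toℕ (f zero))
      step : ∀ j → residue (liftHeight φ (inject₁ j)) ≡ f (inject₁ j) → residue (liftHeight φ (suc j)) ≡ f (suc j)
      step j ih = begin
        residue (b + prefixSum δ (suc j))    ≡⟨ cong (λ p → residue (b + p)) (prefixSum-suc δ j) ⟩
        residue (b + (prefixSum δ i + δ i))  ≡⟨ cong residue (ℤP.+-assoc b (prefixSum δ i) (δ i)) ⟨
        residue (liftHeight φ i + δ i)       ≡⟨ residue-+-delta (liftHeight φ i) (hom i (next i) (inj₂ (inj₁ (Step-next i)))) ih ⟩
        f (next i)                           ≡⟨ cong f (next-inject₁ j) ⟩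
        f (suc j)                            ∎
        where
          open ≡-Reasoning
          i = inject₁ j

  Adj-liftHom : ∀ φ → Adj {m} {n} {w} φ (project (liftHom φ))
  Adj-liftHom φ@((f , hom) , _) = inj₁ λ u v arc → subst (Arc n (f u)) (sym (residue-liftHeight φ v)) (hom u v arc)

module Connectivity (m'' k : ℕ) (w : ℤ) where

  open Lifts (suc m'') k w

  gap : Lift → Lift → Fin m → ℤ
  gap A B v = height A v - height B v

  distance : Lift → Lift → ℕ
  distance A B = ℕΣ.sum (λ v → ∣ gap A B v ∣)

  distance-sym : ∀ A B → distance A B ≡ distance B A
  distance-sym A B = ℕΣ.sum-cong-≗ λ v → ℤP.∣i-j∣≡∣j-i∣ (height A v) (height B v)

  gap-next : ∀ A B i → gap A B (next i) ≡ gap A B i + (slope (height A) i - slope (height B) i)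
  gap-next A B i = telescope (height A (next i)) (height B (next i)) (height A i) (height B i) (jump i)
    where
      telescope : ∀ a′ b′ a b j → a′ - b′ ≡ (a - b) + ((a′ + j - a) - (b′ + j - b))
      telescope = solve-∀

  -- Along an edge of slope σ the potential changes by m σ - T, which is positive for σ = 1 and
  -- negative for σ = -1 as soon as |T| < m; this breaks ties between maximisers of a gap.
  potential : Lift → Fin m → ℤ
  potential A u = + m ℤ.* height A u - T ℤ.* + toℕ u

  potential-next : ∀ A i → potential A (next i) ≡ potential A i + (+ m ℤ.* slope (height A) i - T)
  potential-next A = last-or-inject₁ last inner
    where
      open ≡-Reasoning
      L = height A
      ℓ = fromℕ (suc m'')
      last : potential A (next ℓ) ≡ potential A ℓ + (+ m ℤ.* slope L ℓ - T)
      last = begin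
        + m ℤ.* L (next ℓ) - T ℤ.* + toℕ (next ℓ)
          ≡⟨ cong (λ u → + m ℤ.* L u - T ℤ.* + toℕ u) (next-fromℕ _) ⟩
        + m ℤ.* L zero - T ℤ.* 0ℤ
          ≡⟨ wrap-around (+ suc m'') (L zero) (L ℓ) T ⟩
        + m ℤ.* L ℓ - T ℤ.* + suc m'' + (+ m ℤ.* (L zero + T - L ℓ) - T)
          ≡⟨ cong₂ (λ t σ → + m ℤ.* L ℓ - T ℤ.* + t + (+ m ℤ.* σ - T)) (FinP.toℕ-fromℕ _) (slope-fromℕ L) ⟨
        + m ℤ.* L ℓ - T ℤ.* + toℕ ℓ + (+ m ℤ.* slope L ℓ - T)
          ∎
        where
          wrap-around : ∀ m′ a₀ aₗ T → (1ℤ + m′) ℤ.* a₀ - T ℤ.* 0ℤ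
                                       ≡ (1ℤ + m′) ℤ.* aₗ - T ℤ.* m′ + ((1ℤ + m′) ℤ.* (a₀ + T - aₗ) - T)
          wrap-around = solve-∀
      inner : ∀ j → potential A (next (inject₁ j)) ≡ potential A (inject₁ j) + (+ m ℤ.* slope L (inject₁ j) - T)
      inner j = begin
        + m ℤ.* L (next (inject₁ j)) - T ℤ.* + toℕ (next (inject₁ j))
          ≡⟨ cong (λ u → + m ℤ.* L u - T ℤ.* + toℕ u) (next-inject₁ j) ⟩
        + m ℤ.* L (suc j) - T ℤ.* (1ℤ + + toℕ j)
          ≡⟨ step (+ m) (L (suc j)) (L (inject₁ j)) T (+ toℕ j) ⟩
        + m ℤ.* L (inject₁ j) - T ℤ.* + toℕ j + (+ m ℤ.* (L (suc j) - L (inject₁ j)) - T)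
          ≡⟨ cong₂ (λ t σ → + m ℤ.* L (inject₁ j) - T ℤ.* + t + (+ m ℤ.* σ - T)) (FinP.toℕ-inject₁ j) (slope-inject₁ L j) ⟨
        + m ℤ.* L (inject₁ j) - T ℤ.* + toℕ (inject₁ j) + (+ m ℤ.* slope L (inject₁ j) - T)
          ∎
        where
          step : ∀ M a′ a T t → M ℤ.* a′ - T ℤ.* (1ℤ + t) ≡ M ℤ.* a - T ℤ.* t + (M ℤ.* (a′ - a) - T)
          step = solve-∀

  lowerAt : (Fin m → ℤ) → Fin m → Fin m → ℤ
  lowerAt L p v with v FinP.≟ p
  ... | yes _ = L v - 1ℤ
  ... | no  _ = L v

  lowerAt-cases : ∀ L p v → (v ≡ p × lowerAt L p v ≡ L v - 1ℤ) ⊎ (v ≢ p × lowerAt L p v ≡ L v)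
  lowerAt-cases L p v with v FinP.≟ p
  ... | yes v≡p = inj₁ (v≡p , refl)
  ... | no  v≢p = inj₂ (v≢p , refl)

  lowerAt-elsewhere : ∀ L {p v} → v ≢ p → lowerAt L p v ≡ L v
  lowerAt-elsewhere L {p} {v} v≢p with lowerAt-cases L p v
  ... | inj₁ (v≡p , _) = ⊥-elim (v≢p v≡p)
  ... | inj₂ (_ , eq)  = eq

  module Lowering (A : Lift) (p : Fin m)
                  (out≢1 : slope (height A) p ≢ 1ℤ)
                  (in≢-1 : ∀ i → next i ≡ p → slope (height A) i ≢ -1ℤ) where

    private
      L  = height A
      L′ = lowerAt L p

    vertical : ∀ u → UnitStep (L′ u - L u)
    vertical u with lowerAt-cases L p u
    ... | inj₁ (_ , eq) rewrite eq = subst UnitStep (sym (drop (L u))) down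
      where
        drop : ∀ x → x - 1ℤ - x ≡ -1ℤ
        drop = solve-∀
    ... | inj₂ (_ , eq) rewrite eq = subst UnitStep (sym (ℤP.+-inverseʳ (L u))) stay

    forward : ∀ u → UnitStep (L′ (next u) + jump u - L u)
    forward u with lowerAt-cases L p (next u)
    ... | inj₁ (next-u≡p , eq) rewrite eq =
      subst UnitStep (sym (shift (L (next u)) (jump u) (L u))) (unitStep-pred (slope-unit A u) (in≢-1 u next-u≡p))
      where
        shift : ∀ x j y → x - 1ℤ + j - y ≡ x + j - y - 1ℤ
        shift = solve-∀
    ... | inj₂ (_ , eq) rewrite eq = slope-unit A u

    backward : ∀ u → UnitStep (L (next u) + jump u - L′ u)
    backward u with lowerAt-cases L p u
    ... | inj₁ (refl , eq) rewrite eq =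
      subst UnitStep (sym (shift (L (next u)) (jump u) (L u))) (unitStep-suc (slope-unit A u) out≢1)
      where
        shift : ∀ x j y → x + j - (y - 1ℤ) ≡ x + j - y + 1ℤ
        shift = solve-∀
    ... | inj₂ (_ , eq) rewrite eq = slope-unit A u

    lowered : Lift
    lowered = mkLift L′ slope-unit′
      where
        slope-unit′ : ∀ i → UnitStep (slope L′ i)
        slope-unit′ i with lowerAt-cases L p i
        ... | inj₁ (refl , _) rewrite lowerAt-elsewhere L (next≢id i) = backward i
        ... | inj₂ (_ , eq) rewrite eq = forward i

    Close-lowered : Close L L′
    Close-lowered = vertical , forward , backward

    distance-lowered : ∀ B → 0ℤ ℤ.< gap A B p → distance lowered B < distance A B
    distance-lowered B 0<gap = ℕsum-mono-< _ _ shrinks p (strict p refl)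
      where
        strict : ∀ v → v ≡ p → ∣ L′ v - height B v ∣ < ∣ gap A B v ∣
        strict v v≡p with lowerAt-cases L p v
        ... | inj₂ (v≢p , _) = ⊥-elim (v≢p v≡p)
        ... | inj₁ (refl , eq) rewrite eq =
          subst (λ d → ∣ d ∣ < ∣ gap A B v ∣) (sym (swap (L v) (height B v))) (∣i-1∣<∣i∣ 0<gap)
          where
            swap : ∀ x y → x - 1ℤ - y ≡ x - y - 1ℤ
            swap = solve-∀
        shrinks : ∀ v → ∣ L′ v - height B v ∣ ≤ ∣ gap A B v ∣
        shrinks v with lowerAt-cases L p v
        ... | inj₁ (v≡p , _) = ℕP.<⇒≤ (strict v v≡p)
        ... | inj₂ (_ , eq) rewrite eq = ℕP.≤-refl

  record Peak (A B : Lift) : Set where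
    field
      vertex        : Fin m
      gap-max       : ∀ v → gap A B v ℤ.≤ gap A B vertex
      potential-max : ∀ v → gap A B v ≡ gap A B vertex → potential A v ℤ.≤ potential A vertex

  peak : ∀ A B → Peak A B
  peak A B = fromLexMax (maximiser (×-totalOrder ℤP.≤-decTotalOrder ℤP.≤-totalOrder) (λ v → gap A B v , potential A v))
    where
      fromLexMax : Σ (Fin m) (λ p → ∀ v → ×-Lex _≡_ ℤ._≤_ ℤ._≤_ (gap A B v , potential A v) (gap A B p , potential A p))
                 → Peak A B
      fromLexMax (p , lexMax) = record { vertex = p ; gap-max = gap-max ; potential-max = potential-max }
        where
          gap-max : ∀ v → gap A B v ℤ.≤ gap A B p
          gap-max v with lexMax v
          ... | inj₁ (≤ , _) = ≤
          ... | inj₂ (≡ , _) = ℤP.≤-reflexive ≡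
          potential-max : ∀ v → gap A B v ≡ gap A B p → potential A v ℤ.≤ potential A p
          potential-max v ≡ with lexMax v
          ... | inj₁ (_ , ≢) = ⊥-elim (≢ ≡)
          ... | inj₂ (_ , ≤) = ≤

  data Approach (A B : Lift) : Set where
    lower-left  : ∀ A′ → Close (height A) (height A′) → distance A′ B < distance A B → Approach A B
    lower-right : ∀ B′ → Close (height B) (height B′) → distance A B′ < distance A B → Approach A B
    coincide    : (∀ v → height A v ≡ height B v) → Approach A B

  Approach-flip : ∀ {A B} → Approach B A → Approach A B
  Approach-flip {A} {B} (lower-left B′ close closer)  =
    lower-right B′ close (subst₂ _<_ (distance-sym B′ A) (distance-sym B A) closer)
  Approach-flip {A} {B} (lower-right A′ close closer) =
    lower-left A′ close (subst₂ _<_ (distance-sym B A′) (distance-sym B A) closer)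
  Approach-flip (coincide same) = coincide (sym ∘ same)

  module AtPeak (T<m : T ℤ.< + m) (-m<T : - + m ℤ.< T) {A B : Lift} (P : Peak A B) where

    open Peak P

    slope-out≢1 : slope (height A) vertex ≢ 1ℤ
    slope-out≢1 sA≡1 = rises (slope-unit B vertex)
      (trans (gap-next A B vertex) (cong (λ s → gap A B vertex + (s - slope (height B) vertex)) sA≡1))
      where
        potential-rises : potential A (next vertex) ≡ potential A vertex + (+ m - T)
        potential-rises = trans (potential-next A vertex)
          (cong (λ s → potential A vertex + (s - T)) (trans (cong (+ m ℤ.*_) sA≡1) (ℤP.*-identityʳ (+ m))))
        rises : ∀ {s} → UnitStep s → gap A B (next vertex) ≡ gap A B vertex + (1ℤ - s) → ⊥
        rises down eq = rise-contradiction eq (ℤ.+<+ (s≤s z≤n)) (gap-max (next vertex))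
        rises stay eq = rise-contradiction eq (ℤ.+<+ (s≤s z≤n)) (gap-max (next vertex))
        rises up   eq = rise-contradiction potential-rises (<⇒0<- T<m)
                          (potential-max (next vertex) (trans eq (ℤP.+-identityʳ _)))

    slope-in≢-1 : ∀ i → next i ≡ vertex → slope (height A) i ≢ -1ℤ
    slope-in≢-1 i i→vertex sA≡-1 = rises (slope-unit B i)
      (trans (undo-gap (gap A B i) sB) (cong (_+ (1ℤ + sB)) (sym gap-falls)))
      where
        sB = slope (height B) i
        gap-falls : gap A B vertex ≡ gap A B i + (-1ℤ - sB)
        gap-falls = trans (cong (gap A B) (sym i→vertex))
          (trans (gap-next A B i) (cong (λ s → gap A B i + (s - sB)) sA≡-1))
        potential-falls : potential A vertex ≡ potential A i + (+ m ℤ.* -1ℤ - T)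
        potential-falls = trans (cong (potential A) (sym i→vertex))
          (trans (potential-next A i) (cong (λ s → potential A i + (+ m ℤ.* s - T)) sA≡-1))
        undo-gap : ∀ g s → g ≡ g + (-1ℤ - s) + (1ℤ + s)
        undo-gap = solve-∀
        undo-potential : ∀ x M T → x ≡ x + (M ℤ.* -1ℤ - T) + (T - - M)
        undo-potential = solve-∀
        potential-rises : potential A i ≡ potential A vertex + (T - - + m)
        potential-rises = trans (undo-potential (potential A i) (+ m) T) (cong (_+ (T - - + m)) (sym potential-falls))
        rises : ∀ {s} → UnitStep s → gap A B i ≡ gap A B vertex + (1ℤ + s) → ⊥
        rises up   eq = rise-contradiction eq (ℤ.+<+ (s≤s z≤n)) (gap-max i)
        rises stay eq = rise-contradiction eq (ℤ.+<+ (s≤s z≤n)) (gap-max i)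
        rises down eq = rise-contradiction potential-rises (<⇒0<- -m<T)
                          (potential-max i (trans eq (ℤP.+-identityʳ _)))

    lowerPeak : 0ℤ ℤ.< gap A B vertex → Approach A B
    lowerPeak 0<gap = lower-left lowered Close-lowered (distance-lowered B 0<gap)
      where open Lowering A vertex slope-out≢1 slope-in≢-1

  module _ (T<m : T ℤ.< + m) (-m<T : - + m ℤ.< T) where

    approach : ∀ A B → Approach A B
    approach A B = compare (peak A B) (peak B A)
      where
        nonpositive-gap : ∀ {A B} (P : Peak A B) → ¬ 0ℤ ℤ.< gap A B (Peak.vertex P) → ∀ v → height A v ℤ.≤ height B v
        nonpositive-gap P ≮ v = ℤP.i-j≤0⇒i≤j (ℤP.≤-trans (Peak.gap-max P v) (ℤP.≮⇒≥ ≮))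

        compare : Peak A B → Peak B A → Approach A B
        compare P Q = decide (0ℤ ℤP.<? gap A B (Peak.vertex P)) (0ℤ ℤP.<? gap B A (Peak.vertex Q))
          where
            decide : Dec (0ℤ ℤ.< gap A B (Peak.vertex P)) → Dec (0ℤ ℤ.< gap B A (Peak.vertex Q)) → Approach A B
            decide (yes 0<gapAB) _            = AtPeak.lowerPeak T<m -m<T P 0<gapAB
            decide (no _)        (yes 0<gapBA) = Approach-flip (AtPeak.lowerPeak T<m -m<T Q 0<gapBA)
            decide (no ≮AB)      (no ≮BA)      = coincide λ v →
              ℤP.≤-antisym (nonpositive-gap P ≮AB v) (nonpositive-gap Q ≮BA v)

    connect : ∀ A B → Star (Adj {m} {n} {w}) (project A) (project B)
    connect A B = go A B (On.wellFounded (uncurry distance) ℕInd.<-wellFounded (A , B))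
      where
        go : ∀ A B → Acc (_<_ on uncurry distance) (A , B) → Star (Adj {m} {n} {w}) (project A) (project B)
        go A B (acc closer⇒acc) = along (approach A B)
          where
            along : Approach A B → Star (Adj {m} {n} {w}) (project A) (project B)
            along (lower-left A′ close closer)  = inj₁ (Close⇒HArc {height A} close) ◅ go A′ B (closer⇒acc closer)
            along (lower-right B′ close closer) = go A B′ (closer⇒acc closer) ◅◅ (inj₂ (Close⇒HArc {height B} close) ◅ ε)
            along (coincide same)               = inj₁ arc ◅ ε
              where
                arc : HArc (proj₁ (project A)) (proj₁ (project B))
                arc u v uv = subst (Arc n (residue (height A u)) ∘ residue) (same v) (Close⇒HArc {height A} (Close-refl A) u v uv)

    connected : ∀ (φ ψ : HomW m n w) → Star (Adj {m} {n} {w}) φ ψ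
    connected φ ψ = Adj-liftHom φ ◅ connect (liftHom φ) (liftHom ψ) ◅◅ (Sum.swap (Adj-liftHom ψ) ◅ ε)

module Rigidity (m'' k : ℕ) (w : ℤ) {s : ℤ} (sign : IsSign s) where

  open Lifts (suc m'') (suc k) w

  ≈-unitSteps : ∀ {x y z} → UnitStep x → UnitStep y → UnitStep z → x ≈ y + z → x ≡ y + z
  ≈-unitSteps {x} {y} {z} ux uy uz x≈y+z = ≈⇒≡ x≈y+z (s≤s (ℕP.≤-trans (ℤP.∣i-j∣≤∣i∣+∣j∣ x (y + z))
    (ℕP.+-mono-≤ (∣unitStep∣≤1 ux) (ℕP.≤-trans (ℤP.∣i+j∣≤∣i∣+∣j∣ y z)
      (ℕP.+-mono-≤ (∣unitStep∣≤1 uy) (ℕP.≤-trans (∣unitStep∣≤1 uz) (s≤s z≤n)))))))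

  -- Lifting the arcs c₀c₀, c₀c₁ and c₁c₀ gives unit steps e₀, e₁ = e₀ + s and e₂ = e₀ - s
  -- (here n ≥ 4 is used), which forces e₀ = 0.
  rigid : ∀ a b → (∀ u v → Arc m u v → Arc n (residue (a + s ℤ.* + toℕ u)) (residue (b + s ℤ.* + toℕ v))) →
          residue a ≡ residue b
  rigid a b H = residue-cong (subst (_≈ b) (trans (cong (_+_ a) e₀≡0) (ℤP.+-identityʳ a)) a+e₀≈b)
    where
      lift : ∀ u v → Arc m u v → Σ ℤ λ e → UnitStep e × a + s ℤ.* + toℕ u + e ≈ b + s ℤ.* + toℕ v
      lift u v arc = Arc⇒≈ (a + s ℤ.* + toℕ u) (b + s ℤ.* + toℕ v) (H u v arc)
      loop  = lift zero zero (inj₁ refl)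
      forth = lift zero (suc zero) (inj₂ (inj₁ (inj₁ refl)))
      back  = lift (suc zero) zero (inj₂ (inj₂ (inj₁ refl)))
      e₀ = proj₁ loop
      e₁ = proj₁ forth
      e₂ = proj₁ back
      u₀ = proj₁ (proj₂ loop)
      u₁ = proj₁ (proj₂ forth)
      u₂ = proj₁ (proj₂ back)
      s-unit = isSign⇒unitStep sign
      times-0 : ∀ x s → x + s ℤ.* 0ℤ ≡ x
      times-0 = solve-∀
      times-1 : ∀ x s → x + s ℤ.* 1ℤ ≡ x + s
      times-1 = solve-∀
      a+e₀≈b : a + e₀ ≈ b
      a+e₀≈b = subst₂ (λ x y → x + e₀ ≈ y) (times-0 a s) (times-0 b s) (proj₂ (proj₂ loop))
      a+e₁≈b+s : a + e₁ ≈ b + s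
      a+e₁≈b+s = subst₂ (λ x y → x + e₁ ≈ y) (times-0 a s) (times-1 b s) (proj₂ (proj₂ forth))
      a+s+e₂≈b : a + s + e₂ ≈ b
      a+s+e₂≈b = subst₂ (λ x y → x + e₂ ≈ y) (times-1 a s) (times-0 b s) (proj₂ (proj₂ back))
      e₁≡e₀+s : e₁ ≡ e₀ + s
      e₁≡e₀+s = ≈-unitSteps u₁ u₀ s-unit (≈-cancelˡ a
        (≈-trans a+e₁≈b+s (subst (b + s ≈_) (ℤP.+-assoc a e₀ s) (≈-+ʳ s (≈-sym a+e₀≈b)))))
      e₂≡e₀-s : e₂ ≡ e₀ - s
      e₂≡e₀-s = ≈-unitSteps u₂ u₀ (unitStep-neg s-unit) (≈-cancelˡ a
        (subst₂ _≈_ (shift a s e₂) (ℤP.+-assoc a e₀ (- s)) (≈-+ʳ (- s) (≈-trans a+s+e₂≈b (≈-sym a+e₀≈b)))))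
        where
          shift : ∀ a s e → a + s + e - s ≡ a + e
          shift = solve-∀
      e₀≡0 : e₀ ≡ 0ℤ
      e₀≡0 = unitStep±sign⇒0 sign u₀ (subst UnitStep e₁≡e₀+s u₁) (subst UnitStep e₂≡e₀-s u₂)

  module _ (T≡s*m : T ≡ s ℤ.* + m) where

    slope≡sign : ∀ A i → slope (height A) i ≡ s
    slope≡sign A = all-sign sign T≡s*m
      where
        L = height A
        all-sign : ∀ {s} → IsSign s → T ≡ s ℤ.* + m → ∀ i → slope L i ≡ s
        all-sign positive T≡m = sum-unitSteps≡k⇒up (slope L) (slope-unit A)
          (trans (sum-slope L) (trans T≡m (ℤP.*-identityˡ (+ m))))
        all-sign negative T≡-m i = ℤP.neg-injective (sum-unitSteps≡k⇒up (λ i → - slope L i) (unitStep-neg ∘ slope-unit A)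
          (trans (sum-neg (slope L)) (trans (cong -_ (trans (sum-slope L) (trans T≡-m (ℤP.-1*i≡-i (+ m)))))
                                            (ℤP.neg-involutive (+ m)))) i)

    height-linear : ∀ A u → height A u ≡ height A zero + s ℤ.* + toℕ u
    height-linear A = <-weakInduction (λ u → L u ≡ L zero + s ℤ.* + toℕ u) (sym (times-0 (L zero) s)) step
      where
        L = height A
        times-0 : ∀ x s → x + s ℤ.* 0ℤ ≡ x
        times-0 = solve-∀
        step : ∀ j → L (inject₁ j) ≡ L zero + s ℤ.* + toℕ (inject₁ j) → L (suc j) ≡ L zero + s ℤ.* + toℕ (suc j)
        step j ih = begin
          L (suc j)                                   ≡⟨ xyx⁻¹≈y (L (inject₁ j)) (L (suc j)) ⟨
          L (inject₁ j) + L (suc j) - L (inject₁ j)   ≡⟨ ℤP.+-assoc (L (inject₁ j)) (L (suc j)) _ ⟩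
          L (inject₁ j) + (L (suc j) - L (inject₁ j)) ≡⟨ cong (_+_ (L (inject₁ j))) (slope-inject₁ L j) ⟨
          L (inject₁ j) + slope L (inject₁ j)         ≡⟨ cong (_+_ (L (inject₁ j))) (slope≡sign A (inject₁ j)) ⟩
          L (inject₁ j) + s                           ≡⟨ cong (_+ s) ih ⟩
          L zero + s ℤ.* + toℕ (inject₁ j) + s        ≡⟨ cong (λ t → L zero + s ℤ.* + t + s) (FinP.toℕ-inject₁ j) ⟩
          L zero + s ℤ.* + toℕ j + s                  ≡⟨ distribute (L zero) s (+ toℕ j) ⟩
          L zero + s ℤ.* (1ℤ + + toℕ j)               ∎
          where
            open ≡-Reasoning
            distribute : ∀ x s t → x + s ℤ.* t + s ≡ x + s ℤ.* (1ℤ + t)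
            distribute = solve-∀

    linear : ℤ → Fin m → ℤ
    linear a u = a + s ℤ.* + toℕ u

    slope-linear : ∀ a i → slope (linear a) i ≡ s
    slope-linear a = last-or-inject₁ last inner
      where
        open ≡-Reasoning
        ℓ = fromℕ (suc m'')
        last : slope (linear a) ℓ ≡ s
        last = begin
          slope (linear a) ℓ                                   ≡⟨ slope-fromℕ (linear a) ⟩
          a + s ℤ.* 0ℤ + T - (a + s ℤ.* + toℕ ℓ)
            ≡⟨ cong₂ (λ t l → a + s ℤ.* 0ℤ + t - (a + s ℤ.* + l)) T≡s*m (FinP.toℕ-fromℕ _) ⟩
          a + s ℤ.* 0ℤ + s ℤ.* (1ℤ + + suc m'') - (a + s ℤ.* + suc m'')
            ≡⟨ wrap-around a s (+ suc m'') ⟩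
          s                                                    ∎
          where
            wrap-around : ∀ a s M → a + s ℤ.* 0ℤ + s ℤ.* (1ℤ + M) - (a + s ℤ.* M) ≡ s
            wrap-around = solve-∀
        inner : ∀ j → slope (linear a) (inject₁ j) ≡ s
        inner j = begin
          slope (linear a) (inject₁ j)                         ≡⟨ slope-inject₁ (linear a) j ⟩
          a + s ℤ.* (1ℤ + + toℕ j) - (a + s ℤ.* + toℕ (inject₁ j))
            ≡⟨ cong (λ t → a + s ℤ.* (1ℤ + + toℕ j) - (a + s ℤ.* + t)) (FinP.toℕ-inject₁ j) ⟩
          a + s ℤ.* (1ℤ + + toℕ j) - (a + s ℤ.* + toℕ j)       ≡⟨ step a s (+ toℕ j) ⟩
          s                                                    ∎
          where
            step : ∀ a s t → a + s ℤ.* (1ℤ + t) - (a + s ℤ.* t) ≡ s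
            step = solve-∀

    canonical : Fin n → HomW m n w
    canonical i = project (mkLift (linear (+ toℕ i)) λ u →
      subst UnitStep (sym (slope-linear (+ toℕ i) u)) (isSign⇒unitStep sign))

    canonical-injective : ∀ i j → SameMap {m} {n} {w} (canonical i) (canonical j) → i ≡ j
    canonical-injective i j same = begin
      i                                ≡⟨ residue-toℕ i ⟨
      residue (+ toℕ i)                ≡⟨ cong residue (times-0 (+ toℕ i) s) ⟨
      residue (linear (+ toℕ i) zero)  ≡⟨ same zero ⟩
      residue (linear (+ toℕ j) zero)  ≡⟨ cong residue (times-0 (+ toℕ j) s) ⟩
      residue (+ toℕ j)                ≡⟨ residue-toℕ j ⟩
      j                                ∎
      where
        open ≡-Reasoning
        times-0 : ∀ x s → x + s ℤ.* 0ℤ ≡ x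
        times-0 = solve-∀

    canonical-surjective : ∀ φ → Σ (Fin n) λ i → SameMap {m} {n} {w} φ (canonical i)
    canonical-surjective φ = residue (L zero) , λ u → begin
      proj₁ (proj₁ φ) u                              ≡⟨ residue-liftHeight φ u ⟨
      residue (L u)                                  ≡⟨ cong residue (height-linear (liftHom φ) u) ⟩
      residue (L zero + s ℤ.* + toℕ u)               ≡⟨ residue-cong (≈-+ʳ (s ℤ.* + toℕ u) (≈-residue (L zero))) ⟩
      residue (linear (+ toℕ (residue (L zero))) u)  ∎
      where
        open ≡-Reasoning
        L = liftHeight φ

    Adj⇒SameMap : ∀ φ ψ → Adj {m} {n} {w} φ ψ → SameMap {m} {n} {w} φ ψ
    Adj⇒SameMap φ ψ adj u = trans (φ≗i u) (trans (cong (λ c → proj₁ (proj₁ (canonical c)) u) i≡j) (sym (ψ≗j u)))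
      where
        i = proj₁ (canonical-surjective φ)
        j = proj₁ (canonical-surjective ψ)
        φ≗i = proj₂ (canonical-surjective φ)
        ψ≗j = proj₂ (canonical-surjective ψ)
        index : ∀ {φ ψ i j} → SameMap {m} {n} {w} φ (canonical i) → SameMap {m} {n} {w} ψ (canonical j) →
                HArc (proj₁ φ) (proj₁ ψ) → i ≡ j
        index {i = i} {j} φ≗i ψ≗j H = begin
          i                  ≡⟨ residue-toℕ i ⟨
          residue (+ toℕ i)  ≡⟨ rigid (+ toℕ i) (+ toℕ j) (λ u v arc → subst₂ (Arc n) (φ≗i u) (ψ≗j v) (H u v arc)) ⟩
          residue (+ toℕ j)  ≡⟨ residue-toℕ j ⟩
          j                  ∎
          where open ≡-Reasoning
        i≡j : i ≡ j
        i≡j = Sum.[ index {φ} {ψ} φ≗i ψ≗j , sym ∘ index {ψ} {φ} ψ≗j φ≗i ]′ adj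

module WindComponents (m'' k : ℕ) (w : ℤ) where

  open Lifts (suc m'') (suc k) w

  ∣T∣≡∣w∣*n : ∣ T ∣ ≡ ∣ w ∣ * n
  ∣T∣≡∣w∣*n = ℤP.abs-* w (+ n)

  single-component : ∣ w ∣ * n < m → SingleComponent m n w
  single-component ∣w∣n<m = project (Lift-exists ∣T∣<m) , connected (proj₁ -m<T<m) (proj₂ -m<T<m)
    where
      open Connectivity m'' (suc k) w using (connected)
      ∣T∣<m = subst (_< m) (sym ∣T∣≡∣w∣*n) ∣w∣n<m
      -m<T<m = ∣i∣<n⇒-n<i<n ∣T∣<m

  isolated-vertices : ∣ w ∣ * n ≡ m → IsolatedVertices m n w n
  isolated-vertices ∣w∣n≡m with ∣i∣≡n⇒i≡±n (trans ∣T∣≡∣w∣*n ∣w∣n≡m)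
  ... | s , sign , T≡s*m =
    canonical T≡s*m , canonical-injective T≡s*m , canonical-surjective T≡s*m , Adj⇒SameMap T≡s*m
    where open Rigidity m'' k w sign using (canonical; canonical-injective; canonical-surjective; Adj⇒SameMap)

  empty : m < ∣ w ∣ * n → Empty m n w
  empty m<∣w∣n φ = ℕP.<⇒≱ m<∣w∣n (subst (_≤ m) ∣T∣≡∣w∣*n (∣T∣≤m φ))

-- The hypothesis 0 < |w| of the isolated case is implied by |w| n = m.
fact1p1 : ∀ (m n : ℕ) → 4 ≤ n → n ≤ m → ∀ (w : ℤ) →
    (∣ w ∣ * n < m → SingleComponent m n w)
    × (0 < ∣ w ∣ → ∣ w ∣ * n ≡ m → IsolatedVertices m n w n)
    × (m < ∣ w ∣ * n → Empty m n w)
fact1p1 (suc (suc m'')) (suc (suc (suc (suc k)))) _ _ w = single-component , (λ _ → isolated-vertices) , empty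
  where open WindComponents m'' k w
fact1p1 zero       (suc _)       _ ()       _
fact1p1 (suc zero) (suc (suc _)) _ (s≤s ()) _
fact1p1 _ zero                   ()                   _ _
fact1p1 _ (suc zero)             (s≤s ())             _ _
fact1p1 _ (suc (suc zero))       (s≤s (s≤s ()))       _ _
fact1p1 _ (suc (suc (suc zero))) (s≤s (s≤s (s≤s ()))) _ _
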